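{- Let $G$ be an $n$-vertex totally ordered graph, let $S$ be a set of $s$ vertices of $G$, let $G'=G-S$, let $A$ be the array obtained from the height table of $G$ by deleting the columns indexed by vertices of $S$, and let $A'$ be the height table of $G'$. Then there is a sequence of arrays $\{A_\beta:\beta\in Z\}$ (each as described in the context) such that each column of the initial array $A_\alpha$ ($\alpha$ the minimum of $Z$) contains at most $s$ holes, and for each $\beta\in Z$: (1) if $\delta<\beta$, then $A_\beta(\delta)=A'(\delta)$; (2) if $\delta\ge\beta$ and $A_\beta(\delta)$ does not contain a hole, then $A_\beta(\delta)=A(\delta)$; (3) if $\gamma$ is the successor of $\beta$ in $Z$, then $A_\gamma$ is obtained from $A_\beta$ by swapping the contents of $A_\beta(\beta)$ and $A_\beta(\delta)$ for some $\delta$ in the critical interval of $A_\beta$; moreover, if $\beta$ and $\delta$ index cells in distinct columns $u$ and $v$, then $A_\beta(\delta)$ is the edge $uv$.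
   Context: A totally ordered graph is a finite graph $G$ with a total ordering $T(G)$ of $V(G)$ and a total ordering $T'(G)$ of $E(G)$. The height table of $G$ is an array with columns indexed by $V(G)$ and rows by the positive integers; cell $(i,u)$ precedes $(i',u')$ iff $i<i'$, or $i=i'$ and $u$ precedes $u'$ in $T(G)$; cells are filled in this order, cell $(i,u)$ receiving the largest edge (in $T'(G)$) incident to $u$ not already placed in a preceding cell, or staying empty if none exists. $G-S$ inherits its orderings from $G$. Let $Z=\{1,2,3,\ldots\}\times V(G')$, ordered by $(i,u)\le(i',v)$ iff $i<i'$, or $i=i'$ and $u\le v$ in $T(G')$; the cells of $A$ and $A'$ are indexed by $Z$. Each $A_\beta$ is an array whose cells are indexed by $Z$, each cell being empty, containing an edge of $G'$, or containing an object called a hole, with every edge of $G'$ appearing in exactly one cell of $A_\beta$. For $\beta=(i,u)$, the critical interval of $A_\beta$ is $\{\delta\in Z:(i,u)\le\delta\le(j,u)\}$, where $j$ is the least integer with $j\ge i$ such that $A_\beta(j,u)$ does not contain a hole. -}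

module Defs where

open import Data.Bool using (Bool; true; false; _∧_; _∨_; not; if_then_else_)
open import Data.Nat as ℕ using (ℕ; zero; suc; _+_)
open import Data.Fin as Fin using (Fin; zero; suc)
open import Data.Fin.Properties as FinP using ()
open import Data.Fin.Subset using (Subset; _∈_; _∉_; ∣_∣)
open import Data.Fin.Subset.Properties using (_∈?_)
open import Data.List using (List; []; _∷_; _++_; concat; replicate; foldr; allFin)
open import Data.Maybe using (Maybe; just; nothing)
open import Data.Product using (Σ; _×_; _,_; proj₁; proj₂)
open import Data.Sum using (_⊎_)
open import Function using (_∘_)
open import Relation.Binary.PropositionalEquality using (_≡_; _≢_)
open import Relation.Nullary using (¬_; Dec; yes; no)
open import Relation.Nullary.Decidable using (⌊_⌋)

-- Vertices are Fin n, totally ordered by the usual order of Fin n (T(G));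
-- edges are Fin m, totally ordered by the usual order of Fin m (T'(G));
-- `ends e` gives the two endpoints of edge e.

record TOGraph (n m : ℕ) : Set where
  field
    ends       : Fin m → Fin n × Fin n
    loopless   : ∀ e → proj₁ (ends e) ≢ proj₂ (ends e)
    noParallel : ∀ e f →
                 (ends e ≡ ends f ⊎ ends e ≡ (proj₂ (ends f) , proj₁ (ends f))) →
                 e ≡ f
open TOGraph public

IsEdge : ∀ {n m} → TOGraph n m → Fin m → Fin n → Fin n → Set
IsEdge G e u v = ends G e ≡ (u , v) ⊎ ends G e ≡ (v , u)

incident? : ∀ {n m} → TOGraph n m → Fin m → Fin n → Bool
incident? G e u = ⌊ proj₁ (ends G e) Fin.≟ u ⌋ ∨ ⌊ proj₂ (ends G e) Fin.≟ u ⌋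

-- Height table of the subgraph of G with vertex set {u | V u} and edge
-- set {e | E e}, orderings inherited from G.  Rows are indexed from 0
-- (row 0 here is row 1 of the paper).  Content `nothing` = empty cell.

maxSat : ∀ {k} → (Fin k → Bool) → Maybe (Fin k)
maxSat {zero}  p = nothing
maxSat {suc k} p with maxSat (p ∘ suc)
... | just e  = just (suc e)
... | nothing = if p zero then just zero else nothing

module HeightTable {n m : ℕ} (G : TOGraph n m)
                   (V : Fin n → Bool) (E : Fin m → Bool) where

  choose : (Fin m → Bool) → Fin n → Maybe (Fin m)
  choose placed u = maxSat (λ e → E e ∧ incident? G e u ∧ not (placed e))

  fillCell : (Fin m → Bool) → Fin n → (Fin m → Bool)
  fillCell placed u with choose placed u
  ... | nothing = placed
  ... | just e  = λ f → placed f ∨ ⌊ f Fin.≟ e ⌋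

  run : (Fin m → Bool) → List (Fin n) → (Fin m → Bool)
  run placed []       = placed
  run placed (u ∷ us) = run (fillCell placed u) us

  vertsWhere : (Fin n → Bool) → List (Fin n)
  vertsWhere p = foldr (λ v acc → if p v then v ∷ acc else acc) [] (allFin n)

  row : List (Fin n)
  row = vertsWhere V

  preceding : ℕ → Fin n → List (Fin n)
  preceding i u = concat (replicate i row) ++ vertsWhere (λ v → V v ∧ ⌊ v FinP.<? u ⌋)

  table : ℕ → Fin n → Maybe (Fin m)
  table i u = choose (run (λ _ → false) (preceding i u)) u

allV : ∀ {n} → Fin n → Bool
allV _ = true

allE : ∀ {m} → Fin m → Bool
allE _ = true

notInS : ∀ {n} → Subset n → Fin n → Bool
notInS S u = not ⌊ u ∈? S ⌋

edgeOf-S : ∀ {n m} → TOGraph n m → Subset n → Fin m → Bool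
edgeOf-S G S e = notInS S (proj₁ (ends G e)) ∧ notInS S (proj₂ (ends G e))

-- height table of G (with all columns; A is its restriction to columns not in S)
heightTable : ∀ {n m} → TOGraph n m → ℕ → Fin n → Maybe (Fin m)
heightTable G = HeightTable.table G allV allE

heightTable-S : ∀ {n m} → TOGraph n m → Subset n → ℕ → Fin n → Maybe (Fin m)
heightTable-S G S = HeightTable.table G (notInS S) (edgeOf-S G S)

-- Cells and arrays indexed by Z = rows × V(G - S)

data Cell (m : ℕ) : Set where
  empty : Cell m
  edge  : Fin m → Cell m
  hole  : Cell m

toCell : ∀ {m} → Maybe (Fin m) → Cell m
toCell nothing  = empty
toCell (just e) = edge e

isHole : ∀ {m} → Cell m → Bool
isHole hole = true
isHole _    = false

Pos : ℕ → Set
Pos n = ℕ × Fin n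

Array : ℕ → ℕ → Set
Array n m = ℕ → Fin n → Cell m

at : ∀ {n m} → Array n m → Pos n → Cell m
at A (i , u) = A i u

InZ : ∀ {n} → Subset n → Pos n → Set
InZ S (i , u) = u ∉ S

_<Z_ : ∀ {n} → Pos n → Pos n → Set
(i , u) <Z (j , v) = i ℕ.< j ⊎ (i ≡ j × u Fin.< v)

_≤Z_ : ∀ {n} → Pos n → Pos n → Set
β ≤Z δ = β <Z δ ⊎ β ≡ δ

IsMinZ : ∀ {n} → Subset n → Pos n → Set
IsMinZ S α = InZ S α × (∀ δ → InZ S δ → α ≤Z δ)

IsSuccZ : ∀ {n} → Subset n → Pos n → Pos n → Set
IsSuccZ S β γ = InZ S γ × β <Z γ × (∀ δ → InZ S δ → β <Z δ → γ ≤Z δ)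

WellFormed : ∀ {n m} → TOGraph n m → Subset n → Array n m → Set
WellFormed {n} {m} G S A =
  (∀ δ → InZ S δ → ∀ e → at A δ ≡ edge e → edgeOf-S G S e ≡ true) ×
  (∀ e → edgeOf-S G S e ≡ true →
     Σ (Pos n) (λ δ → InZ S δ × at A δ ≡ edge e) ×
     (∀ δ δ' → InZ S δ → InZ S δ' → at A δ ≡ edge e → at A δ' ≡ edge e → δ ≡ δ'))

holesBelow : ∀ {n m} → Array n m → Fin n → ℕ → ℕ
holesBelow A u zero    = 0
holesBelow A u (suc N) = holesBelow A u N + (if isHole (A N u) then 1 else 0)

InCritical : ∀ {n m} → Subset n → Array n m → Pos n → Pos n → Set
InCritical S A (i , u) δ =
  InZ S δ × (i , u) ≤Z δ ×
  Σ ℕ (λ j → i ℕ.≤ j × A j u ≢ hole × (∀ k → i ℕ.≤ k → k ℕ.< j → A k u ≡ hole) ×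
             δ ≤Z (j , u))

_≟P_ : ∀ {n} (x y : Pos n) → Dec (x ≡ y)
(i , u) ≟P (j , v) with i ℕ.≟ j | u Fin.≟ v
... | yes _≡_.refl | yes _≡_.refl = yes _≡_.refl
... | no i≢j | _ = no λ { _≡_.refl → i≢j _≡_.refl }
... | yes _ | no u≢v = no λ { _≡_.refl → u≢v _≡_.refl }

swap : ∀ {n m} → Array n m → Pos n → Pos n → Array n m
swap A β δ i u with (i , u) ≟P β | (i , u) ≟P δ
... | yes _ | _     = at A δ
... | no _  | yes _ = at A β
... | no _  | no _  = A i u

module Submission where

-- The arrays A_β are produced by a sweep over the cells of Z in order.  The
-- initial array copies the height table A of G, replacing every edge of G
-- that meets S by a hole.  At the cell β = (i , u) the sweep swaps A_β(β)
-- with the cell δ holding the content that A' = height table of G - S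
-- puts at β: the cell of the edge A'(β) if A'(β) is an edge, and otherwise
-- the first non-hole cell (j , u) with j ≥ i, which is then empty.
--
-- The sweep keeps
-- an invariant (well-formedness, agreement with A' before the current cell,
-- with A at non-hole cells after it, no holes beyond some row), from which
-- properties (1)-(3) follow; the hole bound for the initial array comes from
-- an injection of the hole rows of a column into S.

open import Defs
open import Data.Bool using (Bool; true; false; _∧_; not; if_then_else_)
open import Data.Bool.Properties using (∧-identityʳ; ∧-zeroʳ; ∨-zeroʳ)
open import Data.Nat as ℕ using (ℕ; zero; suc; _+_; _∸_; _⊔_; _≤_; _<_; z≤n; s≤s)
import Data.Nat.Properties as ℕP
open import Data.Fin as Fin using (Fin; zero; suc; toℕ)
import Data.Fin.Properties as FinP
open import Data.Fin.Subset using (Subset; _∈_; _∉_; ∣_∣; _-_)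
open import Data.Fin.Subset.Properties using (_∈?_; x∈p⇒∣p-x∣<∣p∣; x∈p∧x≢y⇒x∈p-y)
open import Data.List using (List; []; _∷_; _++_; concat; replicate; foldr; allFin; tabulate)
open import Data.List.Properties using (++-assoc; ++-identityʳ)
open import Data.Maybe using (Maybe; just; nothing)
open import Data.Product using (Σ; _×_; _,_; proj₁; proj₂)
open import Data.Sum using (_⊎_; inj₁; inj₂)
open import Data.Empty using (⊥-elim)
open import Function using (_∘_; id)
open import Relation.Binary.PropositionalEquality
open import Relation.Binary using (tri<; tri≈; tri>)
open import Relation.Nullary using (¬_; Dec; yes; no)
open import Relation.Nullary.Decidable using (⌊_⌋)
open import Function.Bundles using (_⇔_; mk⇔; module Equivalence)

true≢false : true ≢ false
true≢false ()

⌊⌋-yes : ∀ {a} {A : Set a} (d : Dec A) → A → ⌊ d ⌋ ≡ true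
⌊⌋-yes (yes _) _ = refl
⌊⌋-yes (no ¬a) a = ⊥-elim (¬a a)

⌊⌋-no : ∀ {a} {A : Set a} (d : Dec A) → ¬ A → ⌊ d ⌋ ≡ false
⌊⌋-no (yes a) ¬a = ⊥-elim (¬a a)
⌊⌋-no (no _) _ = refl

⌊⌋-witness : ∀ {a} {A : Set a} (d : Dec A) → ⌊ d ⌋ ≡ true → A
⌊⌋-witness (yes a) _ = a

∧-true : ∀ {a b} → a ∧ b ≡ true → a ≡ true × b ≡ true
∧-true {true} b≡true = refl , b≡true

∧-intro : ∀ {a b} → a ≡ true → b ≡ true → a ∧ b ≡ true
∧-intro refl refl = refl

maxSat-nothing : ∀ {k} (p : Fin k → Bool) → maxSat p ≡ nothing → ∀ f → p f ≡ false
maxSat-nothing {suc k} p eq f with maxSat (p ∘ suc) in eq'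
maxSat-nothing {suc k} p eq f | nothing with p zero in pz
maxSat-nothing {suc k} p eq zero    | nothing | false = pz
maxSat-nothing {suc k} p eq (suc f) | nothing | false = maxSat-nothing (p ∘ suc) eq' f

maxSat-just : ∀ {k} (p : Fin k → Bool) e → maxSat p ≡ just e →
  p e ≡ true × (∀ f → p f ≡ true → toℕ f ≤ toℕ e)
maxSat-just {suc k} p e eq with maxSat (p ∘ suc) in eq'
maxSat-just {suc k} p .(suc e') refl | just e' =
  proj₁ IH , λ { zero _ → z≤n ; (suc f) pf → s≤s (proj₂ IH f pf) }
  where
    IH : p (suc e') ≡ true × (∀ f → p (suc f) ≡ true → toℕ f ≤ toℕ e')
    IH = maxSat-just (p ∘ suc) e' eq'
maxSat-just {suc k} p e eq | nothing with p zero in pz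
maxSat-just {suc k} p .zero refl | nothing | true =
  pz , λ { zero _ → z≤n
         ; (suc f) pf → ⊥-elim (true≢false (trans (sym pf) (maxSat-nothing (p ∘ suc) eq' f))) }

-- `vertsWhere` filters allFin n = tabulate id, an enumeration whose j-th
-- entry has index 0 + j.

module Filtering {n : ℕ} where

  filt : (Fin n → Bool) → List (Fin n) → List (Fin n)
  filt p = foldr (λ v acc → if p v then v ∷ acc else acc) []

  below : ℕ → Fin n → Bool
  below k v = ⌊ toℕ v ℕ.<? k ⌋

  indexIs : ℕ → Fin n → Bool
  indexIs k v = ⌊ toℕ v ℕ.≟ k ⌋

  filt-cong : ∀ p q xs → (∀ v → p v ≡ q v) → filt p xs ≡ filt q xs
  filt-cong p q []       p≗q = refl
  filt-cong p q (x ∷ xs) p≗q rewrite p≗q x | filt-cong p q xs p≗q = refl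

  filt-none : ∀ xs → filt (λ _ → false) xs ≡ []
  filt-none []       = refl
  filt-none (x ∷ xs) = filt-none xs

  Consecutive : ∀ {n'} → (Fin n' → Fin n) → ℕ → Set
  Consecutive f c = ∀ j → toℕ (f j) ≡ c + toℕ j

  consecutive-tail : ∀ {n'} {f : Fin (suc n') → Fin n} {c} →
    Consecutive f c → Consecutive (f ∘ suc) (suc c)
  consecutive-tail {c = c} con j = trans (con (suc j)) (ℕP.+-suc c (toℕ j))

  consecutive-head : ∀ {n'} {f : Fin (suc n') → Fin n} {c} → Consecutive f c → toℕ (f zero) ≡ c
  consecutive-head {c = c} con = trans (con zero) (ℕP.+-identityʳ c)

  none-below : ∀ {n'} (f : Fin n' → Fin n) c k (q : Fin n → Bool) → Consecutive f c → k ≤ c →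
    filt (λ v → q v ∧ below k v) (tabulate f) ≡ []
  none-below {zero}   f c k q con k≤c = refl
  none-below {suc n'} f c k q con k≤c
    rewrite ⌊⌋-no (toℕ (f zero) ℕ.<? k)
              (ℕP.≤⇒≯ (subst (k ≤_) (sym (consecutive-head con)) k≤c))
          | ∧-zeroʳ (q (f zero))
    = none-below (f ∘ suc) (suc c) k q (consecutive-tail con) (ℕP.m≤n⇒m≤1+n k≤c)

  none-at : ∀ {n'} (f : Fin n' → Fin n) c k (q : Fin n → Bool) → Consecutive f c → k < c →
    filt (λ v → q v ∧ indexIs k v) (tabulate f) ≡ []
  none-at {zero}   f c k q con k<c = refl
  none-at {suc n'} f c k q con k<c
    rewrite ⌊⌋-no (toℕ (f zero) ℕ.≟ k)
              (λ eq → ℕP.<⇒≢ k<c (sym (trans (sym (consecutive-head con)) eq)))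
          | ∧-zeroʳ (q (f zero))
    = none-at (f ∘ suc) (suc c) k q (consecutive-tail con) (ℕP.m<n⇒m<1+n k<c)

  below-suc : ∀ {n'} (f : Fin n' → Fin n) c k (q : Fin n → Bool) → Consecutive f c →
    filt (λ v → q v ∧ below (suc k) v) (tabulate f) ≡
    filt (λ v → q v ∧ below k v) (tabulate f) ++ filt (λ v → q v ∧ indexIs k v) (tabulate f)
  below-suc {zero}   f c k q con = refl
  below-suc {suc n'} f c k q con with ℕP.<-cmp c k
  ... | tri< c<k _ _
    rewrite ⌊⌋-yes (toℕ (f zero) ℕ.<? suc k) (subst (_< suc k) (sym (consecutive-head con)) (ℕP.m<n⇒m<1+n c<k))
          | ⌊⌋-yes (toℕ (f zero) ℕ.<? k) (subst (_< k) (sym (consecutive-head con)) c<k)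
          | ⌊⌋-no (toℕ (f zero) ℕ.≟ k) (λ eq → ℕP.<⇒≢ c<k (trans (sym (consecutive-head con)) eq))
          | ∧-zeroʳ (q (f zero)) | ∧-identityʳ (q (f zero))
          | below-suc (f ∘ suc) (suc c) k q (consecutive-tail con)
    with q (f zero)
  ... | true  = refl
  ... | false = refl
  below-suc {suc n'} f c k q con | tri≈ _ refl _
    rewrite ⌊⌋-yes (toℕ (f zero) ℕ.<? suc c) (subst (_< suc c) (sym (consecutive-head con)) ℕP.≤-refl)
          | ⌊⌋-no (toℕ (f zero) ℕ.<? c) (ℕP.<-irrefl (consecutive-head con))
          | ⌊⌋-yes (toℕ (f zero) ℕ.≟ c) (consecutive-head con)
          | ∧-zeroʳ (q (f zero)) | ∧-identityʳ (q (f zero))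
          | none-below (f ∘ suc) (suc c) (suc c) q (consecutive-tail con) ℕP.≤-refl
          | none-below (f ∘ suc) (suc c) c q (consecutive-tail con) (ℕP.n≤1+n c)
          | none-at (f ∘ suc) (suc c) c q (consecutive-tail con) ℕP.≤-refl
    with q (f zero)
  ... | true  = refl
  ... | false = refl
  below-suc {suc n'} f c k q con | tri> _ _ k<c
    rewrite none-below f c (suc k) q con k<c
          | none-below f c k q con (ℕP.<⇒≤ k<c)
          | none-at f c k q con k<c = refl

  at-index : ∀ {n'} (f : Fin n' → Fin n) c k (q : Fin n → Bool) → Consecutive f c →
    (filt (λ v → q v ∧ indexIs k v) (tabulate f) ≡ [] × (∀ j → toℕ (f j) ≡ k → q (f j) ≡ false))
    ⊎ Σ (Fin n') (λ j → filt (λ v → q v ∧ indexIs k v) (tabulate f) ≡ f j ∷ []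
                        × toℕ (f j) ≡ k × q (f j) ≡ true)
  at-index {zero}   f c k q con = inj₁ (refl , λ ())
  at-index {suc n'} f c k q con with toℕ (f zero) ℕ.≟ k
  ... | yes head≡k
    rewrite none-at (f ∘ suc) (suc c) k q (consecutive-tail con)
              (subst (_< suc c) (trans (sym (consecutive-head con)) head≡k) ℕP.≤-refl)
    with q (f zero) in qf
  ... | true  = inj₂ (zero , refl , head≡k , qf)
  ... | false = inj₁ (refl , λ { zero _ → qf ; (suc j) eq → ⊥-elim (later j eq) })
    where
      later : ∀ j → toℕ (f (suc j)) ≢ k
      later j eq = ℕP.<-irrefl (trans (sym (consecutive-head con)) head≡k)
        (subst (c <_) eq (subst (suc c ≤_) (sym (consecutive-tail con j)) (ℕP.m≤m+n (suc c) (toℕ j))))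
  at-index {suc n'} f c k q con | no head≢k
    rewrite ∧-zeroʳ (q (f zero))
    with at-index (f ∘ suc) (suc c) k q (consecutive-tail con)
  ... | inj₁ (none , notQ) = inj₁ (none , λ { zero eq → ⊥-elim (head≢k eq) ; (suc j) eq → notQ j eq })
  ... | inj₂ (j , one , idx , qj) = inj₂ (suc j , one , idx , qj)

-- (i' , u') ≺ (i , k): the cell (i' , u') is filled before the cell in row
-- i and column of index k.  For Fin-indexed cells this is exactly _<Z_.

_≺_ : ∀ {n} → Pos n → ℕ × ℕ → Set
(i' , u') ≺ (i , k) = i' < i ⊎ (i' ≡ i × toℕ u' < k)

⌜_⌝ : ∀ {n} → Pos n → ℕ × ℕ
⌜ i , u ⌝ = i , toℕ u

≺-irrefl : ∀ {n} (a : Pos n) → ¬ a ≺ ⌜ a ⌝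
≺-irrefl a (inj₁ lt)       = ℕP.<-irrefl refl lt
≺-irrefl a (inj₂ (_ , lt)) = ℕP.<-irrefl refl lt

≺-asym : ∀ {n} (a b : Pos n) → a ≺ ⌜ b ⌝ → ¬ b ≺ ⌜ a ⌝
≺-asym a b (inj₁ l₁)       (inj₁ l₂)       = ℕP.<-asym l₁ l₂
≺-asym a b (inj₁ l₁)       (inj₂ (e , _))  = ℕP.<-irrefl (sym e) l₁
≺-asym a b (inj₂ (e , _))  (inj₁ l₂)       = ℕP.<-irrefl (sym e) l₂
≺-asym a b (inj₂ (_ , l₁)) (inj₂ (_ , l₂)) = ℕP.<-asym l₁ l₂

≺-trichotomy : ∀ {n} (a b : Pos n) → a ≺ ⌜ b ⌝ ⊎ a ≡ b ⊎ b ≺ ⌜ a ⌝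
≺-trichotomy (i , u) (j , v) with ℕP.<-cmp i j
... | tri< lt _ _ = inj₁ (inj₁ lt)
... | tri> _ _ gt = inj₂ (inj₂ (inj₁ gt))
... | tri≈ _ refl _ with ℕP.<-cmp (toℕ u) (toℕ v)
... | tri< lt _ _ = inj₁ (inj₂ (refl , lt))
... | tri> _ _ gt = inj₂ (inj₂ (inj₂ (refl , gt)))
... | tri≈ _ eq _ rewrite FinP.toℕ-injective eq = inj₂ (inj₁ refl)

≺-suc : ∀ {n} {δ : Pos n} {i k} → δ ≺ (i , suc k) → δ ≺ (i , k) ⊎ (proj₁ δ ≡ i × toℕ (proj₂ δ) ≡ k)
≺-suc (inj₁ l) = inj₁ (inj₁ l)
≺-suc (inj₂ (e , l)) with ℕP.m≤n⇒m<n∨m≡n (ℕ.s≤s⁻¹ l)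
... | inj₁ l' = inj₁ (inj₂ (e , l'))
... | inj₂ e' = inj₂ (e , e')

≺-weaken : ∀ {n} {δ : Pos n} {i k} → δ ≺ (i , k) → δ ≺ (i , suc k)
≺-weaken (inj₁ l)       = inj₁ l
≺-weaken (inj₂ (e , l)) = inj₂ (e , ℕP.m<n⇒m<1+n l)

≺-nextRow : ∀ {n} {δ : Pos n} {i} → δ ≺ (suc i , 0) → δ ≺ (i , n)
≺-nextRow {δ = δ} (inj₁ l) with ℕP.m≤n⇒m<n∨m≡n (ℕ.s≤s⁻¹ l)
... | inj₁ l' = inj₁ l'
... | inj₂ e  = inj₂ (e , FinP.toℕ<n (proj₂ δ))

≺-prevRow : ∀ {n} {δ : Pos n} {i} → δ ≺ (i , n) → δ ≺ (suc i , 0)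
≺-prevRow (inj₁ l)          = inj₁ (ℕP.m<n⇒m<1+n l)
≺-prevRow (inj₂ (refl , _)) = inj₁ ℕP.≤-refl

≤Z⇒⊀ : ∀ {n} (β δ : Pos n) → β ≤Z δ → ¬ δ ≺ ⌜ β ⌝
≤Z⇒⊀ β δ (inj₁ lt)   = ≺-asym β δ lt
≤Z⇒⊀ β δ (inj₂ refl) = ≺-irrefl β

≤Z-antisym : ∀ {n} (β δ : Pos n) → β ≤Z δ → δ ≤Z β → δ ≡ β
≤Z-antisym β δ (inj₂ refl) _         = refl
≤Z-antisym β δ (inj₁ β<δ) δ≤β        = ⊥-elim (≤Z⇒⊀ δ β δ≤β β<δ)

⊀⇒≤Z : ∀ {n} (β δ : Pos n) → ¬ δ ≺ ⌜ β ⌝ → β ≤Z δ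
⊀⇒≤Z β δ δ⊀β with ≺-trichotomy δ β
... | inj₁ lt         = ⊥-elim (δ⊀β lt)
... | inj₂ (inj₁ eq)  = inj₂ (sym eq)
... | inj₂ (inj₂ lt)  = inj₁ lt

-- For the subgraph with vertex predicate V and edge predicate E,
-- `placed i k` is the set of edges placed before the cell of row i and
-- column index k.  It consists exactly of the table entries of earlier
-- cells (`placed⇔earlier`); hence each cell holds the largest eligible
-- edge not in an earlier cell, and each edge occupies at most one cell.

module HeightTableFacts {n m : ℕ} (G : TOGraph n m) (V : Fin n → Bool) (E : Fin m → Bool) where
  open HeightTable G V E public
  open Filtering {n}

  Eligible : (Fin m → Bool) → Fin n → Fin m → Bool
  Eligible done u f = E f ∧ incident? G f u ∧ not (done f)

  -- the edges placed before cell (i , k); table i u = choose (placed i (toℕ u)) u by definition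
  placed : ℕ → ℕ → Fin m → Bool
  placed i k = run (λ _ → false) (concat (replicate i row) ++ filt (λ v → V v ∧ below k v) (allFin n))

  EarlierCell : ℕ → ℕ → Fin m → Set
  EarlierCell i k f = Σ (Pos n) (λ c → V (proj₂ c) ≡ true × c ≺ (i , k) × table (proj₁ c) (proj₂ c) ≡ just f)

  run-++ : ∀ p xs ys → run p (xs ++ ys) ≡ run (run p xs) ys
  run-++ p []       ys = refl
  run-++ p (x ∷ xs) ys = run-++ (fillCell p x) xs ys

  nothing-below-0 : filt (λ v → V v ∧ below 0 v) (allFin n) ≡ []
  nothing-below-0 = trans (filt-cong _ _ (allFin n) (λ v → ∧-zeroʳ (V v))) (filt-none (allFin n))

  placed-origin : ∀ f → placed 0 0 f ≡ false
  placed-origin f = cong (λ l → run (λ _ → false) l f) nothing-below-0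

  placed-nextRow : ∀ i → placed (suc i) 0 ≡ placed i n
  placed-nextRow i = cong (run (λ _ → false)) (begin
      (row ++ rows) ++ filt (λ v → V v ∧ below 0 v) (allFin n)
    ≡⟨ cong ((row ++ rows) ++_) nothing-below-0 ⟩
      (row ++ rows) ++ []
    ≡⟨ ++-identityʳ _ ⟩
      row ++ rows
    ≡⟨ rows-comm i ⟩
      rows ++ row
    ≡⟨ cong (rows ++_) (filt-cong _ _ (allFin n) all-below-n) ⟩
      rows ++ filt (λ v → V v ∧ below n v) (allFin n) ∎)
    where
      open ≡-Reasoning
      rows : List (Fin n)
      rows = concat (replicate i row)
      rows-comm : ∀ i → row ++ concat (replicate i row) ≡ concat (replicate i row) ++ row
      rows-comm zero    = ++-identityʳ row
      rows-comm (suc i) = trans (cong (row ++_) (rows-comm i)) (sym (++-assoc row (concat (replicate i row)) row))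
      all-below-n : ∀ v → V v ≡ V v ∧ below n v
      all-below-n v = sym (trans (cong (V v ∧_) (⌊⌋-yes (toℕ v ℕ.<? n) (FinP.toℕ<n v))) (∧-identityʳ (V v)))

  placed-suc : ∀ i k → placed i (suc k) ≡ run (placed i k) (filt (λ v → V v ∧ indexIs k v) (allFin n))
  placed-suc i k = begin
      run (λ _ → false) (rows ++ filt (λ v → V v ∧ below (suc k) v) (allFin n))
    ≡⟨ cong (λ l → run (λ _ → false) (rows ++ l)) (below-suc id 0 k V (λ _ → refl)) ⟩
      run (λ _ → false) (rows ++ (filt (λ v → V v ∧ below k v) (allFin n) ++ filt (λ v → V v ∧ indexIs k v) (allFin n)))
    ≡⟨ cong (run (λ _ → false)) (sym (++-assoc rows _ _)) ⟩
      run (λ _ → false) ((rows ++ filt (λ v → V v ∧ below k v) (allFin n)) ++ filt (λ v → V v ∧ indexIs k v) (allFin n))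
    ≡⟨ run-++ (λ _ → false) (rows ++ filt (λ v → V v ∧ below k v) (allFin n)) _ ⟩
      run (placed i k) (filt (λ v → V v ∧ indexIs k v) (allFin n)) ∎
    where
      open ≡-Reasoning
      rows : List (Fin n)
      rows = concat (replicate i row)

  fillCell-member : ∀ p w f → fillCell p w f ≡ true → p f ≡ true ⊎ choose p w ≡ just f
  fillCell-member p w f h with choose p w
  ... | nothing = inj₁ h
  ... | just e with p f
  ... | true = inj₁ refl
  ... | false with f Fin.≟ e
  ... | yes refl = inj₂ refl

  fillCell-old : ∀ p w f → p f ≡ true → fillCell p w f ≡ true
  fillCell-old p w f h with choose p w
  ... | nothing = h
  ... | just e rewrite h = refl

  fillCell-new : ∀ p w f → choose p w ≡ just f → fillCell p w f ≡ true
  fillCell-new p w f h with choose p w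
  fillCell-new p w f refl | just e rewrite ⌊⌋-yes (e Fin.≟ e) refl = ∨-zeroʳ (p e)

  earlier-relocate : ∀ {i k i' k' f} → (∀ {δ : Pos n} → δ ≺ (i , k) → δ ≺ (i' , k')) →
    EarlierCell i k f → EarlierCell i' k' f
  earlier-relocate mono (c , vc , lt , t) = c , vc , mono lt , t

  placed⇔earlier : ∀ i k f → (placed i k f ≡ true) ⇔ EarlierCell i k f
  placed⇔earlier zero zero f =
    mk⇔ (λ h → ⊥-elim (true≢false (trans (sym h) (placed-origin f))))
        (λ { (_ , _ , inj₁ () , _) ; (_ , _ , inj₂ (_ , ()) , _) })
  placed⇔earlier (suc i) zero f =
    mk⇔ (λ h → earlier-relocate ≺-prevRow (to (trans (sym same) h)))
        (λ c → trans same (from (earlier-relocate ≺-nextRow c)))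
    where
      open Equivalence (placed⇔earlier i n f)
      same : placed (suc i) 0 f ≡ placed i n f
      same = cong (λ p → p f) (placed-nextRow i)
  placed⇔earlier i (suc k) f with at-index id 0 k V (λ _ → refl)
  ... | inj₁ (none , notV) =
    mk⇔ (λ h → earlier-relocate ≺-weaken (to (trans (sym same) h)))
        (λ c → trans same (from (skip c)))
    where
      open Equivalence (placed⇔earlier i k f)
      same : placed i (suc k) f ≡ placed i k f
      same = cong (λ p → p f) (trans (placed-suc i k) (cong (run (placed i k)) none))
      skip : EarlierCell i (suc k) f → EarlierCell i k f
      skip (c , vc , lt , t) with ≺-suc lt
      ... | inj₁ lt'       = c , vc , lt' , t
      ... | inj₂ (_ , idx) = ⊥-elim (true≢false (trans (sym vc) (notV (proj₂ c) idx)))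
  ... | inj₂ (w , one , idx , Vw) = mk⇔ fwd bwd
    where
      open Equivalence (placed⇔earlier i k f)
      same : placed i (suc k) f ≡ fillCell (placed i k) w f
      same = cong (λ p → p f) (trans (placed-suc i k) (cong (run (placed i k)) one))
      table-w : table i w ≡ choose (placed i k) w
      table-w = cong (λ k' → choose (placed i k') w) idx
      fwd : placed i (suc k) f ≡ true → EarlierCell i (suc k) f
      fwd h with fillCell-member (placed i k) w f (trans (sym same) h)
      ... | inj₁ old    = earlier-relocate ≺-weaken (to old)
      ... | inj₂ chosen = (i , w) , Vw , inj₂ (refl , subst (_< suc k) (sym idx) ℕP.≤-refl) , trans table-w chosen
      bwd : EarlierCell i (suc k) f → placed i (suc k) f ≡ true
      bwd (c , vc , lt , t) with ≺-suc lt
      ... | inj₁ lt' = trans same (fillCell-old (placed i k) w f (from (c , vc , lt' , t)))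
      ... | inj₂ (refl , idx') with FinP.toℕ-injective (trans idx' (sym idx))
      ... | refl = trans same (fillCell-new (placed i k) w f (trans (sym table-w) t))

  eligible-parts : ∀ p u f → Eligible p u f ≡ true →
    E f ≡ true × incident? G f u ≡ true × p f ≡ false
  eligible-parts p u f h with E f | incident? G f u | p f
  ... | true | true | false = refl , refl , refl

  table-eligible : ∀ i u e → table i u ≡ just e → Eligible (placed i (toℕ u)) u e ≡ true
  table-eligible i u e t = proj₁ (maxSat-just _ e t)

  table-maximal : ∀ i u e → table i u ≡ just e →
    ∀ f → Eligible (placed i (toℕ u)) u f ≡ true → toℕ f ≤ toℕ e
  table-maximal i u e t = proj₂ (maxSat-just _ e t)

  table-nothing : ∀ i u → table i u ≡ nothing → ∀ f → Eligible (placed i (toℕ u)) u f ≡ false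
  table-nothing i u t = maxSat-nothing _ t

  table-inE : ∀ i u e → table i u ≡ just e → E e ≡ true
  table-inE i u e t = proj₁ (eligible-parts (placed i (toℕ u)) u e (table-eligible i u e t))

  table-incident : ∀ i u e → table i u ≡ just e → incident? G e u ≡ true
  table-incident i u e t = proj₁ (proj₂ (eligible-parts (placed i (toℕ u)) u e (table-eligible i u e t)))

  table-fresh : ∀ i u e → table i u ≡ just e → ¬ EarlierCell i (toℕ u) e
  table-fresh i u e t earlier =
    true≢false (trans (sym (Equivalence.from (placed⇔earlier i (toℕ u) e) earlier))
                      (proj₂ (proj₂ (eligible-parts (placed i (toℕ u)) u e (table-eligible i u e t)))))

  fresh⇒eligible : ∀ i u f → E f ≡ true → incident? G f u ≡ true → ¬ EarlierCell i (toℕ u) f →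
    Eligible (placed i (toℕ u)) u f ≡ true
  fresh⇒eligible i u f ef inc fresh with placed i (toℕ u) f in p
  ... | false = ∧-intro ef (∧-intro inc refl)
  ... | true  = ⊥-elim (fresh (Equivalence.to (placed⇔earlier i (toℕ u) f) p))

  table-dominates : ∀ i u f → E f ≡ true → incident? G f u ≡ true → ¬ EarlierCell i (toℕ u) f →
    Σ (Fin m) (λ e → table i u ≡ just e × toℕ f ≤ toℕ e)
  table-dominates i u f ef inc fresh with table i u in t
  ... | just e  = e , refl , table-maximal i u e t f (fresh⇒eligible i u f ef inc fresh)
  ... | nothing = ⊥-elim (true≢false (trans (sym (fresh⇒eligible i u f ef inc fresh)) (table-nothing i u t f)))

  table-injective : ∀ c c' f → V (proj₂ c) ≡ true → V (proj₂ c') ≡ true →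
    table (proj₁ c) (proj₂ c) ≡ just f → table (proj₁ c') (proj₂ c') ≡ just f → c ≡ c'
  table-injective c c' f v v' t t' with ≺-trichotomy c c'
  ... | inj₁ lt         = ⊥-elim (table-fresh (proj₁ c') (proj₂ c') f t' (c , v , lt , t))
  ... | inj₂ (inj₁ eq)  = eq
  ... | inj₂ (inj₂ lt)  = ⊥-elim (table-fresh (proj₁ c) (proj₂ c) f t (c' , v' , lt , t'))

  filled-rows<m : ∀ k v → V v ≡ true → (∀ r → r ≤ k → Σ (Fin m) (λ f → table r v ≡ just f)) → k < m
  filled-rows<m k v vv filled with k ℕ.<? m
  ... | yes k<m = k<m
  ... | no k≮m with FinP.pigeonhole (s≤s (ℕP.≮⇒≥ k≮m)) (λ r → proj₁ (filled (toℕ r) (row≤k r)))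
    where
      row≤k : (r : Fin (suc k)) → toℕ r ≤ k
      row≤k r = ℕ.s≤s⁻¹ (FinP.toℕ<n r)
  ... | a , b , a<b , same = ⊥-elim (ℕP.<-irrefl (cong proj₁ a≡b) a<b)
    where
      row≤k : (r : Fin (suc k)) → toℕ r ≤ k
      row≤k r = ℕ.s≤s⁻¹ (FinP.toℕ<n r)
      a≡b : (toℕ a , v) ≡ (toℕ b , v)
      a≡b = table-injective (toℕ a , v) (toℕ b , v) _ vv vv
              (proj₂ (filled (toℕ a) (row≤k a)))
              (subst (λ x → table (toℕ b) v ≡ just x) (sym same) (proj₂ (filled (toℕ b) (row≤k b))))

  -- nonempty cells lie in rows below m: the cells below an edge's cell are nonempty
  table-row<m : ∀ k v f → V v ≡ true → table k v ≡ just f → k < m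
  table-row<m k v f vv t = filled-rows<m k v vv below-filled
    where
      below-filled : ∀ r → r ≤ k → Σ (Fin m) (λ f' → table r v ≡ just f')
      below-filled r r≤k = proj₁ d , proj₁ (proj₂ d)
        where
          fresh : ¬ EarlierCell r (toℕ v) f
          fresh (c , vc , lt , t') with table-injective c (k , v) f vc vv t' t
          ... | refl = ≺-irrefl (k , v) (earlier-row lt)
            where
              earlier-row : (k , v) ≺ (r , toℕ v) → (k , v) ≺ (k , toℕ v)
              earlier-row (inj₁ k<r)    = ⊥-elim (ℕP.<-irrefl refl (ℕP.<-≤-trans k<r r≤k))
              earlier-row (inj₂ (_ , l)) = inj₂ (refl , l)
          d : Σ (Fin m) (λ e → table r v ≡ just e × toℕ f ≤ toℕ e)
          d = table-dominates r v f (table-inE k v f t) (table-incident k v f t) fresh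

  table-complete : ∀ f v → E f ≡ true → incident? G f v ≡ true → V v ≡ true → EarlierCell (suc m) 0 f
  table-complete f v ef inc vv with placed (suc m) 0 f in p
  ... | true  = Equivalence.to (placed⇔earlier (suc m) 0 f) p
  ... | false = ⊥-elim (ℕP.<-irrefl refl (filled-rows<m m v vv filled))
    where
      filled : ∀ r → r ≤ m → Σ (Fin m) (λ f' → table r v ≡ just f')
      filled r r≤m = proj₁ d , proj₁ (proj₂ d)
        where
          before-row-m+1 : ∀ (c : Pos n) → c ≺ (r , toℕ v) → c ≺ (suc m , 0)
          before-row-m+1 c (inj₁ l)          = inj₁ (ℕP.<-≤-trans l (ℕP.m≤n⇒m≤1+n r≤m))
          before-row-m+1 c (inj₂ (refl , _)) = inj₁ (s≤s r≤m)
          fresh : ¬ EarlierCell r (toℕ v) f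
          fresh (c , vc , lt , t') =
            true≢false (trans (sym (Equivalence.from (placed⇔earlier (suc m) 0 f) (c , vc , before-row-m+1 c lt , t'))) p)
          d : Σ (Fin m) (λ e → table r v ≡ just e × toℕ f ≤ toℕ e)
          d = table-dominates r v f ef inc fresh

module _ {n m : ℕ} (G : TOGraph n m) where

  incident⇒endpoint : ∀ e u → incident? G e u ≡ true → proj₁ (ends G e) ≡ u ⊎ proj₂ (ends G e) ≡ u
  incident⇒endpoint e u h with proj₁ (ends G e) Fin.≟ u | proj₂ (ends G e) Fin.≟ u
  ... | yes p | _     = inj₁ p
  ... | no _  | yes q = inj₂ q

  endpoint⇒incident : ∀ e u → proj₁ (ends G e) ≡ u ⊎ proj₂ (ends G e) ≡ u → incident? G e u ≡ true
  endpoint⇒incident e u (inj₁ refl) rewrite ⌊⌋-yes (proj₁ (ends G e) Fin.≟ proj₁ (ends G e)) refl = refl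
  endpoint⇒incident e u (inj₂ refl) rewrite ⌊⌋-yes (proj₂ (ends G e) Fin.≟ proj₂ (ends G e)) refl = ∨-zeroʳ _

  incident⇒IsEdge : ∀ e u v → incident? G e u ≡ true → incident? G e v ≡ true → u ≢ v → IsEdge G e u v
  incident⇒IsEdge e u v iu iv u≢v with incident⇒endpoint e u iu | incident⇒endpoint e v iv
  ... | inj₁ a | inj₁ b = ⊥-elim (u≢v (trans (sym a) b))
  ... | inj₁ a | inj₂ b = inj₁ (cong₂ _,_ a b)
  ... | inj₂ a | inj₁ b = inj₂ (cong₂ _,_ b a)
  ... | inj₂ a | inj₂ b = ⊥-elim (u≢v (trans (sym a) b))

  IsEdge-unique : ∀ e e' u w → IsEdge G e u w → IsEdge G e' u w → e ≡ e'
  IsEdge-unique e e' u w (inj₁ a) (inj₁ b) = noParallel G e e' (inj₁ (trans a (sym b)))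
  IsEdge-unique e e' u w (inj₁ a) (inj₂ b) = noParallel G e e' (inj₂ (trans a (cong₂ _,_ (cong proj₂ (sym b)) (cong proj₁ (sym b)))))
  IsEdge-unique e e' u w (inj₂ a) (inj₁ b) = noParallel G e e' (inj₂ (trans a (cong₂ _,_ (cong proj₂ (sym b)) (cong proj₁ (sym b)))))
  IsEdge-unique e e' u w (inj₂ a) (inj₂ b) = noParallel G e e' (inj₁ (trans a (sym b)))

_≟C_ : ∀ {m} (x y : Cell m) → Dec (x ≡ y)
empty  ≟C empty  = yes refl
empty  ≟C edge _ = no λ ()
empty  ≟C hole   = no λ ()
edge _ ≟C empty  = no λ ()
edge e ≟C edge f with e Fin.≟ f
... | yes refl = yes refl
... | no e≢f   = no λ { refl → e≢f refl }
edge _ ≟C hole   = no λ ()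
hole   ≟C empty  = no λ ()
hole   ≟C edge _ = no λ ()
hole   ≟C hole   = yes refl

toCell-edge : ∀ {m} (x : Maybe (Fin m)) f → toCell x ≡ edge f → x ≡ just f
toCell-edge (just e) f refl = refl

edge≢hole : ∀ {m} {e : Fin m} → edge e ≢ hole
edge≢hole ()

holds : ∀ {m} → Cell m → Fin m → Bool
holds (edge f) e = ⌊ f Fin.≟ e ⌋
holds empty    e = false
holds hole     e = false

holds-true : ∀ {m} (c : Cell m) e → holds c e ≡ true → c ≡ edge e
holds-true (edge f) e h = cong edge (⌊⌋-witness (f Fin.≟ e) h)

holds-edge : ∀ {m} (e : Fin m) → holds (edge e) e ≡ true
holds-edge e = ⌊⌋-yes (e Fin.≟ e) refl

isHole-true : ∀ {m} (c : Cell m) → isHole c ≡ true → c ≡ hole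
isHole-true hole _ = refl

holesFrom : ∀ {n m} → Array n m → Fin n → ℕ → ℕ → Bool
holesFrom B u r zero    = true
holesFrom B u r (suc d) = isHole (B r u) ∧ holesFrom B u (suc r) d

holesFrom-sound : ∀ {n m} (B : Array n m) u r d → holesFrom B u r d ≡ true →
  ∀ t → t < d → B (r + t) u ≡ hole
holesFrom-sound B u r (suc d) h zero _ with B r u in eq | B (r + 0) u in eq'
... | hole | _ = trans (sym eq') (trans (cong (λ x → B x u) (ℕP.+-identityʳ r)) eq)
holesFrom-sound B u r (suc d) h (suc t) lt with B r u
... | hole = subst (λ x → B x u ≡ hole) (sym (ℕP.+-suc r t)) (holesFrom-sound B u (suc r) d h t (ℕ.s≤s⁻¹ lt))

holesFrom-complete : ∀ {n m} (B : Array n m) u r d → (∀ t → t < d → B (r + t) u ≡ hole) →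
  holesFrom B u r d ≡ true
holesFrom-complete B u r zero    h = refl
holesFrom-complete B u r (suc d) h
  rewrite subst (λ x → B x u ≡ hole) (ℕP.+-identityʳ r) (h 0 (s≤s z≤n))
  = holesFrom-complete B u (suc r) d (λ t lt → subst (λ x → B x u ≡ hole) (ℕP.+-suc r t) (h (suc t) (s≤s lt)))

inHoleRun : ∀ {n m} → Array n m → ℕ → Fin n → ℕ → Fin n → Bool
inHoleRun B i u k v = ⌊ v Fin.≟ u ⌋ ∧ ⌊ i ℕ.<? k ⌋ ∧ holesFrom B u i (k ∸ i)

inHoleRun-sound : ∀ {n m} (B : Array n m) i u k v → inHoleRun B i u k v ≡ true →
  v ≡ u × i < k × (∀ r → i ≤ r → r < k → B r u ≡ hole)
inHoleRun-sound B i u k v h with v Fin.≟ u | i ℕ.<? k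
... | yes refl | yes i<k = refl , i<k , holes
  where
    holes : ∀ r → i ≤ r → r < k → B r u ≡ hole
    holes r i≤r r<k = subst (λ x → B x u ≡ hole) (ℕP.m+[n∸m]≡n i≤r)
                        (holesFrom-sound B u i (k ∸ i) h (r ∸ i) (ℕP.∸-monoˡ-< r<k i≤r))

inHoleRun-complete : ∀ {n m} (B : Array n m) i u k → i < k → (∀ r → i ≤ r → r < k → B r u ≡ hole) →
  inHoleRun B i u k u ≡ true
inHoleRun-complete B i u k i<k holes
  rewrite ⌊⌋-yes (u Fin.≟ u) refl | ⌊⌋-yes (i ℕ.<? k) i<k =
  holesFrom-complete B u i (k ∸ i) (λ t t<k∸i →
    holes (i + t) (ℕP.m≤m+n i t) (subst (i + t <_) (ℕP.m+[n∸m]≡n (ℕP.<⇒≤ i<k)) (ℕP.+-monoʳ-< i t<k∸i)))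

record FirstNonHole {n m} (B : Array n m) (u : Fin n) (i : ℕ) : Set where
  field
    j            : ℕ
    i≤j          : i ≤ j
    non-hole     : B j u ≢ hole
    holes-before : ∀ r → i ≤ r → r < j → B r u ≡ hole

first-non-hole : ∀ {n m} (B : Array n m) u d i → B (i + d) u ≢ hole →
  Σ (FirstNonHole B u i) (λ F → FirstNonHole.j F ≤ i + d)
first-non-hole B u d i h with B i u ≟C hole
... | no nh = record { j = i ; i≤j = ℕP.≤-refl ; non-hole = nh
                     ; holes-before = λ r i≤r r<i → ⊥-elim (ℕP.<-irrefl refl (ℕP.<-≤-trans r<i i≤r)) }
            , ℕP.m≤m+n i d
first-non-hole B u zero i h | yes ih = ⊥-elim (h (subst (λ x → B x u ≡ hole) (sym (ℕP.+-identityʳ i)) ih))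
first-non-hole B u (suc d) i h | yes ih
  with first-non-hole B u d (suc i) (subst (λ x → B x u ≢ hole) (ℕP.+-suc i d) h)
... | F , j≤ = record { j = j ; i≤j = ℕP.<⇒≤ i≤j ; non-hole = non-hole ; holes-before = holes }
             , subst (j ≤_) (sym (ℕP.+-suc i d)) j≤
  where
    open FirstNonHole F
    holes : ∀ r → i ≤ r → r < j → B r u ≡ hole
    holes r i≤r r<j with ℕP.m≤n⇒m<n∨m≡n i≤r
    ... | inj₁ i<r  = holes-before r i<r r<j
    ... | inj₂ refl = ih

-- swap B β δ reads B through the transposition of β and δ.  Any array
-- obtained from a well-formed one by such a relabelling of Z is again
-- well-formed.

module _ {n : ℕ} where

  transpose : Pos n → Pos n → Pos n → Pos n
  transpose β δ ε with ε ≟P β | ε ≟P δ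
  ... | yes _ | _     = δ
  ... | no _  | yes _ = β
  ... | no _  | no _  = ε

  swap-transpose : ∀ {m} (B : Array n m) β δ ε → at (swap B β δ) ε ≡ at B (transpose β δ ε)
  swap-transpose B β δ (i , u) with (i , u) ≟P β | (i , u) ≟P δ
  ... | yes _ | _        = refl
  ... | no _  | yes refl = refl
  ... | no _  | no _     = refl

  transpose-β : ∀ β δ → transpose β δ β ≡ δ
  transpose-β β δ with β ≟P β
  ... | yes _   = refl
  ... | no β≢β  = ⊥-elim (β≢β refl)

  transpose-δ : ∀ β δ → δ ≢ β → transpose β δ δ ≡ β
  transpose-δ β δ δ≢β with δ ≟P β | δ ≟P δ
  ... | yes eq | _      = ⊥-elim (δ≢β eq)
  ... | no _   | yes _  = refl
  ... | no _   | no δ≢δ = ⊥-elim (δ≢δ refl)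

  transpose-other : ∀ β δ ε → ε ≢ β → ε ≢ δ → transpose β δ ε ≡ ε
  transpose-other β δ ε ε≢β ε≢δ with ε ≟P β | ε ≟P δ
  ... | yes eq | _      = ⊥-elim (ε≢β eq)
  ... | no _   | yes eq = ⊥-elim (ε≢δ eq)
  ... | no _   | no _   = refl

  transpose-involutive : ∀ β δ ε → transpose β δ (transpose β δ ε) ≡ ε
  transpose-involutive β δ ε = by-cases (ε ≟P β) (ε ≟P δ) (δ ≟P β)
    where
      by-cases : Dec (ε ≡ β) → Dec (ε ≡ δ) → Dec (δ ≡ β) → transpose β δ (transpose β δ ε) ≡ ε
      by-cases (yes refl) _ (yes refl) = trans (cong (transpose ε ε) (transpose-β ε ε)) (transpose-β ε ε)
      by-cases (yes refl) _ (no δ≢ε)   = trans (cong (transpose ε δ) (transpose-β ε δ)) (transpose-δ ε δ δ≢ε)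
      by-cases (no ε≢β) (yes refl) _   = trans (cong (transpose β ε) (transpose-δ β ε ε≢β)) (transpose-β β ε)
      by-cases (no ε≢β) (no ε≢δ) _     = trans (cong (transpose β δ) fixed) fixed
        where
          fixed : transpose β δ ε ≡ ε
          fixed = transpose-other β δ ε ε≢β ε≢δ

  transpose-Z : ∀ (S : Subset n) β δ ε → InZ S β → InZ S δ → InZ S ε → InZ S (transpose β δ ε)
  transpose-Z S β δ ε zβ zδ zε with ε ≟P β | ε ≟P δ
  ... | yes _ | _     = zδ
  ... | no _  | yes _ = zβ
  ... | no _  | no _  = zε

  wellFormed-relabel : ∀ {m} (G : TOGraph n m) (S : Subset n) (B B' : Array n m) (τ : Pos n → Pos n) →
    (∀ ε → InZ S ε → InZ S (τ ε)) → (∀ ε → τ (τ ε) ≡ ε) →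
    (∀ ε → InZ S ε → at B' ε ≡ at B (τ ε)) → WellFormed G S B → WellFormed G S B'
  wellFormed-relabel G S B B' τ τ-Z τ-inv B'≡Bτ (edges-ok , located) =
    (λ ε z e h → edges-ok (τ ε) (τ-Z ε z) e (trans (sym (B'≡Bτ ε z)) h)) ,
    λ e e-ok → let ((δ , zδ , Bδ) , unique) = located e e-ok in
      (τ δ , τ-Z δ zδ , trans (B'≡Bτ (τ δ) (τ-Z δ zδ)) (trans (cong (at B) (τ-inv δ)) Bδ)) ,
      λ ε ε' z z' h h' →
        trans (sym (τ-inv ε))
              (trans (cong τ (unique (τ ε) (τ ε') (τ-Z ε z) (τ-Z ε' z')
                                     (trans (sym (B'≡Bτ ε z)) h) (trans (sym (B'≡Bτ ε' z')) h')))
                     (τ-inv ε'))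

holes-injection : ∀ {n m} (B : Array n m) u (g : ℕ → Fin n) →
  (∀ r r' → B r u ≡ hole → B r' u ≡ hole → g r ≡ g r' → r ≡ r') →
  ∀ N (T : Subset n) → (∀ r → r < N → B r u ≡ hole → g r ∈ T) → holesBelow B u N ≤ ∣ T ∣
holes-injection B u g g-inj zero    T g∈T = z≤n
holes-injection B u g g-inj (suc N) T g∈T with isHole (B N u) in isH
... | false = subst (_≤ ∣ T ∣) (sym (ℕP.+-identityʳ _))
                (holes-injection B u g g-inj N T (λ r r<N → g∈T r (ℕP.m<n⇒m<1+n r<N)))
... | true  = subst (_≤ ∣ T ∣) (ℕP.+-comm 1 _)
                (ℕP.<-≤-trans (s≤s (holes-injection B u g g-inj N (T - g N) g∈T-gN))
                              (x∈p⇒∣p-x∣<∣p∣ (g∈T N ℕP.≤-refl holeN)))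
  where
    holeN : B N u ≡ hole
    holeN = isHole-true _ isH
    g∈T-gN : ∀ r → r < N → B r u ≡ hole → g r ∈ T - g N
    g∈T-gN r r<N h = x∈p∧x≢y⇒x∈p-y (g∈T r (ℕP.m<n⇒m<1+n r<N) h)
                                    (λ eq → ℕP.<-irrefl (g-inj r N h holeN eq) r<N)

notInS-true : ∀ {n} (S : Subset n) u → u ∉ S → notInS S u ≡ true
notInS-true S u u∉S rewrite ⌊⌋-no (u ∈? S) u∉S = refl

notInS⇒∉ : ∀ {n} (S : Subset n) u → notInS S u ≡ true → u ∉ S
notInS⇒∉ S u h with u ∈? S
... | no u∉S = u∉S

notInS-false : ∀ {n} (S : Subset n) u → notInS S u ≡ false → u ∈ S
notInS-false S u h with u ∈? S
... | yes u∈S = u∈S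

-- Starting from `initial`, the cells of Z are visited in order; visiting
-- β = (i , u) performs `move`, which puts A'(β) at β.  `state i k` is the
-- array before the cell of row i and column index k is visited.

module Sweep {n m : ℕ} (G : TOGraph n m) (S : Subset n) where
  module A  = HeightTableFacts G allV allE
  module A' = HeightTableFacts G (notInS S) (edgeOf-S G S)

  A[_] : Pos n → Cell m
  A[ δ ] = toCell (heightTable G (proj₁ δ) (proj₂ δ))

  A'[_] : Pos n → Cell m
  A'[ δ ] = toCell (heightTable-S G S (proj₁ δ) (proj₂ δ))

  initCell : Maybe (Fin m) → Cell m
  initCell nothing  = empty
  initCell (just e) = if edgeOf-S G S e then edge e else hole

  initial : Array n m
  initial k v = initCell (heightTable G k v)

  -- β receives e; the Z-cell that held e receives the old content of β
  moveEdge : Array n m → Pos n → Fin m → Array n m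
  moveEdge B β e k v with (k , v) ≟P β
  ... | yes _ = edge e
  ... | no _  = if notInS S v ∧ holds (B k v) e then at B β else B k v

  -- β = (i , u) becomes empty; the cells of column u below it up to the
  -- first non-hole cell become holes
  moveEmpty : Array n m → ℕ → Fin n → Array n m
  moveEmpty B i u k v with (k , v) ≟P (i , u)
  ... | yes _ = empty
  ... | no _  = if inHoleRun B i u k v then hole else B k v

  move : Array n m → ℕ → Fin n → Maybe (Fin m) → Array n m
  move B i u (just e) = moveEdge B (i , u) e
  move B i u nothing  = moveEmpty B i u

  visit : Array n m → ℕ → Fin n → Array n m
  visit B i u with u ∈? S
  ... | yes _ = B
  ... | no _  = move B i u (heightTable-S G S i u)

  step : Array n m → ℕ → ℕ → Array n m
  step B i k with k ℕ.<? n
  ... | yes k<n = visit B i (Fin.fromℕ< k<n)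
  ... | no _    = B

  state : ℕ → ℕ → Array n m
  state i       (suc k) = step (state i k) i k
  state zero    zero    = initial
  state (suc i) zero    = state i n

  Arr : Pos n → Array n m
  Arr (i , u) = state i (toℕ u)

  moveEdge-β : ∀ B β e → at (moveEdge B β e) β ≡ edge e
  moveEdge-β B (i , u) e with (i , u) ≟P (i , u)
  ... | yes _   = refl
  ... | no β≢β  = ⊥-elim (β≢β refl)

  moveEdge-other : ∀ B β e k v → (k , v) ≢ β →
    moveEdge B β e k v ≡ (if notInS S v ∧ holds (B k v) e then at B β else B k v)
  moveEdge-other B β e k v ε≢β with (k , v) ≟P β
  ... | yes eq = ⊥-elim (ε≢β eq)
  ... | no _   = refl

  moveEdge-swap : ∀ B β δ e → InZ S δ → at B δ ≡ edge e → (∀ ε → InZ S ε → at B ε ≡ edge e → ε ≡ δ) →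
    ∀ ε → InZ S ε → at (moveEdge B β e) ε ≡ at (swap B β δ) ε
  moveEdge-swap B β δ e zδ Bδ unique ε z = trans (by-cases (ε ≟P β)) (sym (swap-transpose B β δ ε))
    where
      by-cases : Dec (ε ≡ β) → at (moveEdge B β e) ε ≡ at B (transpose β δ ε)
      by-cases (yes refl) = trans (moveEdge-β B ε e) (sym (trans (cong (at B) (transpose-β ε δ)) Bδ))
      by-cases (no ε≢β) with at B ε ≟C edge e
      ... | yes Bε with unique ε z Bε
      ...   | refl = begin
          moveEdge B β e (proj₁ ε) (proj₂ ε)
        ≡⟨ moveEdge-other B β e (proj₁ ε) (proj₂ ε) ε≢β ⟩
          (if notInS S (proj₂ ε) ∧ holds (at B ε) e then at B β else at B ε)
        ≡⟨ cong (λ b → if b then at B β else at B ε)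
                (cong₂ _∧_ (notInS-true S (proj₂ ε) z) (trans (cong (λ c → holds c e) Bε) (holds-edge e))) ⟩
          at B β
        ≡⟨ cong (at B) (sym (transpose-δ β ε ε≢β)) ⟩
          at B (transpose β ε ε) ∎
        where open ≡-Reasoning
      by-cases (no ε≢β) | no ¬Bε = begin
          moveEdge B β e (proj₁ ε) (proj₂ ε)
        ≡⟨ moveEdge-other B β e (proj₁ ε) (proj₂ ε) ε≢β ⟩
          (if notInS S (proj₂ ε) ∧ holds (at B ε) e then at B β else at B ε)
        ≡⟨ cong (λ b → if b then at B β else at B ε)
                (trans (cong (notInS S (proj₂ ε) ∧_) (holds-false (at B ε) ¬Bε)) (∧-zeroʳ _)) ⟩
          at B ε
        ≡⟨ cong (at B) (sym (transpose-other β δ ε ε≢β ε≢δ)) ⟩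
          at B (transpose β δ ε) ∎
        where
          open ≡-Reasoning
          ε≢δ : ε ≢ δ
          ε≢δ refl = ¬Bε Bδ
          holds-false : ∀ c → c ≢ edge e → holds c e ≡ false
          holds-false c c≢e with holds c e in h
          ... | false = refl
          ... | true  = ⊥-elim (c≢e (holds-true c e h))

  moveEmpty-β : ∀ B i u → moveEmpty B i u i u ≡ empty
  moveEmpty-β B i u with (i , u) ≟P (i , u)
  ... | yes _  = refl
  ... | no β≢β = ⊥-elim (β≢β refl)

  moveEmpty-other : ∀ B i u k v → (k , v) ≢ (i , u) →
    moveEmpty B i u k v ≡ (if inHoleRun B i u k v then hole else B k v)
  moveEmpty-other B i u k v ε≢β with (k , v) ≟P (i , u)
  ... | yes eq = ⊥-elim (ε≢β eq)
  ... | no _   = refl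

  moveEmpty-swap : ∀ B i u (F : FirstNonHole B u i) → B (FirstNonHole.j F) u ≡ empty →
    ∀ ε → at (moveEmpty B i u) ε ≡ at (swap B (i , u) (FirstNonHole.j F , u)) ε
  moveEmpty-swap B i u F Bj-empty (k , v) =
    trans (by-cases ((k , v) ≟P (i , u)) ((k , v) ≟P (j , u))) (sym (swap-transpose B (i , u) (j , u) (k , v)))
    where
      open FirstNonHole F
      if-true : ∀ {b} → b ≡ true → (if b then hole else B k v) ≡ hole
      if-true refl = refl
      by-cases : Dec ((k , v) ≡ (i , u)) → Dec ((k , v) ≡ (j , u)) →
        moveEmpty B i u k v ≡ at B (transpose (i , u) (j , u) (k , v))
      by-cases (yes refl) _ = trans (moveEmpty-β B i u) (sym (trans (cong (at B) (transpose-β (i , u) (j , u))) Bj-empty))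
      by-cases (no ε≢β) (yes refl) = begin
          moveEmpty B i u j u
        ≡⟨ moveEmpty-other B i u j u ε≢β ⟩
          (if inHoleRun B i u j u then hole else B j u)
        ≡⟨ if-true (inHoleRun-complete B i u j i<j holes-before) ⟩
          hole
        ≡⟨ sym (holes-before i ℕP.≤-refl i<j) ⟩
          B i u
        ≡⟨ cong (at B) (sym (transpose-δ (i , u) (j , u) ε≢β)) ⟩
          at B (transpose (i , u) (j , u) (j , u)) ∎
        where
          open ≡-Reasoning
          i<j : i < j
          i<j with ℕP.m≤n⇒m<n∨m≡n i≤j
          ... | inj₁ lt = lt
          ... | inj₂ refl = ⊥-elim (ε≢β refl)
      by-cases (no ε≢β) (no ε≢δ) =
        trans (moveEmpty-other B i u k v ε≢β)
              (trans (below-run (inHoleRun B i u k v) refl)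
                     (cong (at B) (sym (transpose-other (i , u) (j , u) (k , v) ε≢β ε≢δ))))
        where
          -- inside the hole run the cell is already a hole
          below-run : ∀ b → inHoleRun B i u k v ≡ b → (if b then hole else B k v) ≡ B k v
          below-run false _ = refl
          below-run true run with inHoleRun-sound B i u k v run
          ... | refl , i<k , holes = sym (holes-before k (ℕP.<⇒≤ i<k) k<j)
            where
              k<j : k < j
              k<j with ℕP.<-cmp k j
              ... | tri< lt _ _ = lt
              ... | tri≈ _ refl _ = ⊥-elim (ε≢δ refl)
              ... | tri> _ _ gt = ⊥-elim (non-hole (holes j i≤j gt))

  record Invariant (i k : ℕ) (B : Array n m) : Set where
    field
      wellFormed   : WellFormed G S B
      settled      : ∀ δ → InZ S δ → δ ≺ (i , k) → at B δ ≡ A'[ δ ]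
      pending      : ∀ δ → InZ S δ → ¬ δ ≺ (i , k) → at B δ ≢ hole → at B δ ≡ A[ δ ]
      holeFreeFrom : ℕ
      holeFree     : ∀ r v → holeFreeFrom ≤ r → v ∉ S → B r v ≢ hole

  record SwapTarget (i : ℕ) (u : Fin n) (B : Array n m) (K : ℕ) (t : Maybe (Fin m)) : Set where
    field
      δ          : Pos n
      critical   : InCritical S B (i , u) δ
      β-hole     : δ ≢ (i , u) → B i u ≡ hole
      content    : at B δ ≡ toCell t
      row-bound  : proj₁ δ ≤ K ⊔ i
      cross-edge : u ≢ proj₂ δ → Σ (Fin m) (λ e → at B δ ≡ edge e × IsEdge G e u (proj₂ δ))
      is-swap    : ∀ ε → InZ S ε → at (move B i u t) ε ≡ at (swap B (i , u) δ) ε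

  module Target (i : ℕ) (u : Fin n) (u∉S : u ∉ S) (B : Array n m) (inv : Invariant i (toℕ u) B) where
    open Invariant inv

    β : Pos n
    β = i , u

    unique-cell : ∀ f δ δ' → InZ S δ → InZ S δ' → at B δ ≡ edge f → at B δ' ≡ edge f → δ ≡ δ'
    unique-cell f δ δ' z z' Bδ Bδ' = proj₂ (proj₂ wellFormed f (proj₁ wellFormed δ z f Bδ)) δ δ' z z' Bδ Bδ'

    pending-edge : ∀ c → InZ S c → ¬ c ≺ ⌜ β ⌝ → ∀ f → at B c ≡ edge f →
      heightTable G (proj₁ c) (proj₂ c) ≡ just f
    pending-edge c z c⊀β f Bc = toCell-edge _ f (trans (sym (pending c z c⊀β (λ h → edge≢hole (trans (sym Bc) h)))) Bc)

    available : ∀ f c → InZ S c → at B c ≡ edge f → ¬ c ≺ ⌜ β ⌝ → incident? G f u ≡ true →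
      A'.Eligible (A'.placed i (toℕ u)) u f ≡ true
    available f c z Bc c⊀β inc = A'.fresh⇒eligible i u f (proj₁ wellFormed c z f Bc) inc fresh
      where
        fresh : ¬ A'.EarlierCell i (toℕ u) f
        fresh (c' , v' , lt , t) = c⊀β (subst (_≺ ⌜ β ⌝) c'≡c lt)
          where
            z' : InZ S c'
            z' = notInS⇒∉ S (proj₂ c') v'
            c'≡c : c' ≡ c
            c'≡c = unique-cell f c' c z' z (trans (settled c' z' lt) (cong toCell t)) Bc

    -- the first non-hole cell (j , u) at or below β; it exists since row holeFreeFrom ⊔ i has no holes
    K : ℕ
    K = holeFreeFrom ⊔ i

    first : Σ (FirstNonHole B u i) (λ F → FirstNonHole.j F ≤ i + (K ∸ i))
    first = first-non-hole B u (K ∸ i) i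
              (subst (λ x → B x u ≢ hole) (sym (ℕP.m+[n∸m]≡n (ℕP.m≤n⊔m holeFreeFrom i)))
                     (holeFree K u (ℕP.m≤m⊔n holeFreeFrom i) u∉S))

    F : FirstNonHole B u i
    F = proj₁ first
    open FirstNonHole F

    j≤K : j ≤ K
    j≤K = subst (j ≤_) (ℕP.m+[n∸m]≡n (ℕP.m≤n⊔m holeFreeFrom i)) (proj₂ first)

    j⊀β : ¬ (j , u) ≺ ⌜ β ⌝
    j⊀β (inj₁ j<i)       = ℕP.<-irrefl refl (ℕP.<-≤-trans j<i i≤j)
    j⊀β (inj₂ (_ , u<u)) = ℕP.<-irrefl refl u<u

    critical-upto : ∀ δ → InZ S δ → β ≤Z δ → δ ≤Z (j , u) → InCritical S B β δ
    critical-upto δ z β≤δ δ≤j = z , β≤δ , j , i≤j , non-hole , holes-before , δ≤j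

    row-upto : ∀ (δ : Pos n) → δ ≤Z (j , u) → proj₁ δ ≤ K
    row-upto δ (inj₁ (inj₁ lt))       = ℕP.≤-trans (ℕP.<⇒≤ lt) j≤K
    row-upto δ (inj₁ (inj₂ (refl , _))) = j≤K
    row-upto δ (inj₂ refl)            = j≤K

    β-only : ∀ δ → B i u ≢ hole → β ≤Z δ → δ ≤Z (j , u) → δ ≡ β
    β-only δ nh β≤δ δ≤j with ℕP.m≤n⇒m<n∨m≡n i≤j
    ... | inj₁ i<j  = ⊥-elim (nh (holes-before i ℕP.≤-refl i<j))
    ... | inj₂ i≡j = ≤Z-antisym β δ β≤δ (subst (λ x → δ ≤Z (x , u)) (sym i≡j) δ≤j)

    -- A'(β) = e: swap with the cell δ of e, which lies in the critical
    -- interval because e is the largest edge incident to u not placed by A'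
    -- before β
    module EdgeCase (e : Fin m) (A'β : heightTable-S G S i u ≡ just e) where
      location : Σ (Pos n) (λ δ → InZ S δ × at B δ ≡ edge e)
      location = proj₁ (proj₂ wellFormed e (A'.table-inE i u e A'β))

      δ : Pos n
      δ = proj₁ location

      zδ : InZ S δ
      zδ = proj₁ (proj₂ location)

      Bδ : at B δ ≡ edge e
      Bδ = proj₂ (proj₂ location)

      e∼u : incident? G e u ≡ true
      e∼u = A'.table-incident i u e A'β

      -- before β, B agrees with A', which places e only at β
      δ⊀β : ¬ δ ≺ ⌜ β ⌝
      δ⊀β lt = A'.table-fresh i u e A'β
                 (δ , notInS-true S _ zδ , lt , toCell-edge _ e (trans (sym (settled δ zδ lt)) Bδ))

      Aδ : heightTable G (proj₁ δ) (proj₂ δ) ≡ just e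
      Aδ = pending-edge δ zδ δ⊀β e Bδ

      -- if (j , u) came before δ, A would put an edge f ≥ e at (j , u); B agrees
      -- with A there, so f is available to A' at β and f ≤ e; then f = e
      -- would sit at both (j , u) and δ
      j⊀δ : ¬ (j , u) ≺ ⌜ δ ⌝
      j⊀δ j<δ with A.table-dominates j u e refl e∼u e-fresh
        where
          e-fresh : ¬ A.EarlierCell j (toℕ u) e
          e-fresh (c , _ , c<j , Ac) with A.table-injective c δ e refl refl Ac Aδ
          ... | refl = ≺-asym (j , u) c j<δ c<j
      ... | f , Aj , e≤f = ≺-irrefl (j , u) (subst (λ x → (j , u) ≺ ⌜ x ⌝) (sym j≡δ) j<δ)
        where
          Bj : B j u ≡ edge f
          Bj = trans (pending (j , u) u∉S j⊀β non-hole) (cong toCell Aj)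
          f≤e : toℕ f ≤ toℕ e
          f≤e = A'.table-maximal i u e A'β f (available f (j , u) u∉S Bj j⊀β (A.table-incident j u f Aj))
          j≡δ : (j , u) ≡ δ
          j≡δ = unique-cell e (j , u) δ u∉S zδ
                  (subst (λ x → B j u ≡ edge x) (FinP.toℕ-injective (ℕP.≤-antisym f≤e e≤f)) Bj) Bδ

      δ≤j : δ ≤Z (j , u)
      δ≤j = ⊀⇒≤Z δ (j , u) j⊀δ

      β-hole : δ ≢ β → B i u ≡ hole
      β-hole δ≢β with B i u ≟C hole
      ... | yes h  = h
      ... | no nh  = ⊥-elim (δ≢β (β-only δ nh (⊀⇒≤Z β δ δ⊀β) δ≤j))

      target : SwapTarget i u B holeFreeFrom (just e)
      target = record
        { δ = δ ; critical = critical-upto δ zδ (⊀⇒≤Z β δ δ⊀β) δ≤j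
        ; β-hole = β-hole ; content = Bδ ; row-bound = row-upto δ δ≤j
        ; cross-edge = λ u≢v → e , Bδ , incident⇒IsEdge G e u (proj₂ δ) e∼u
                                         (A.table-incident (proj₁ δ) (proj₂ δ) e Aδ) u≢v
        ; is-swap = moveEdge-swap B β δ e zδ Bδ (λ ε z Bε → unique-cell e ε δ z zδ Bε Bδ) }

    -- A'(β) is empty: swap with (j , u), which is empty, since otherwise its
    -- edge would be available to A' at β
    emptyTarget : heightTable-S G S i u ≡ nothing → SwapTarget i u B holeFreeFrom nothing
    emptyTarget A'β = record
      { δ = j , u ; critical = critical-upto (j , u) u∉S (⊀⇒≤Z β (j , u) j⊀β) (inj₂ refl)
      ; β-hole = λ j≢i → holes-before i ℕP.≤-refl (i<j j≢i) ; content = Bj-empty ; row-bound = j≤K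
      ; cross-edge = λ u≢u → ⊥-elim (u≢u refl)
      ; is-swap = λ ε _ → moveEmpty-swap B i u F Bj-empty ε }
      where
        i<j : (j , u) ≢ β → i < j
        i<j j≢i with ℕP.m≤n⇒m<n∨m≡n i≤j
        ... | inj₁ lt  = lt
        ... | inj₂ eq  = ⊥-elim (j≢i (cong (_, u) (sym eq)))

        Bj-empty : B j u ≡ empty
        Bj-empty with heightTable G j u in Aj | pending (j , u) u∉S j⊀β non-hole
        ... | nothing | Bj = Bj
        ... | just f  | Bj = ⊥-elim (true≢false
                (trans (sym (available f (j , u) u∉S Bj j⊀β (A.table-incident j u f Aj))) (A'.table-nothing i u A'β f)))

  swap-target : ∀ i u → u ∉ S → ∀ B (inv : Invariant i (toℕ u) B) →
    SwapTarget i u B (Invariant.holeFreeFrom inv) (heightTable-S G S i u)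
  swap-target i u u∉S B inv with heightTable-S G S i u in A'β
  ... | just e  = Target.EdgeCase.target i u u∉S B inv e A'β
  ... | nothing = Target.emptyTarget i u u∉S B inv A'β

  -- visiting a cell of Z: the swap settles β and disturbs nothing before it
  invariant-move : ∀ i u → u ∉ S → ∀ B → Invariant i (toℕ u) B →
    Invariant i (suc (toℕ u)) (move B i u (heightTable-S G S i u))
  invariant-move i u u∉S B inv = record
    { wellFormed = wellFormed-relabel G S B B' (transpose β δ) (λ ε → transpose-Z S β δ ε u∉S zδ)
                     (transpose-involutive β δ) B'≡B∘τ wellFormed
    ; settled = settled' ; pending = pending' ; holeFreeFrom = suc K ; holeFree = holeFree' }
    where
      open Invariant inv
      open SwapTarget (swap-target i u u∉S B inv)
      β : Pos n
      β = i , u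
      K : ℕ
      K = holeFreeFrom ⊔ i
      B' : Array n m
      B' = move B i u (heightTable-S G S i u)
      zδ : InZ S δ
      zδ = proj₁ critical
      δ⊀β : ¬ δ ≺ ⌜ β ⌝
      δ⊀β = ≤Z⇒⊀ β δ (proj₁ (proj₂ critical))

      B'≡B∘τ : ∀ ε → InZ S ε → at B' ε ≡ at B (transpose β δ ε)
      B'≡B∘τ ε z = trans (is-swap ε z) (swap-transpose B β δ ε)

      unchanged : ∀ ε → InZ S ε → ε ≢ β → ε ≢ δ → at B' ε ≡ at B ε
      unchanged ε z ε≢β ε≢δ = trans (B'≡B∘τ ε z) (cong (at B) (transpose-other β δ ε ε≢β ε≢δ))

      settled' : ∀ ε → InZ S ε → ε ≺ (i , suc (toℕ u)) → at B' ε ≡ A'[ ε ]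
      settled' ε z lt with ≺-suc lt
      ... | inj₁ ε<β = trans (unchanged ε z (λ { refl → ≺-irrefl β ε<β }) (λ ε≡δ → δ⊀β (subst (_≺ ⌜ β ⌝) ε≡δ ε<β)))
                             (settled ε z ε<β)
      ... | inj₂ (refl , idx) with FinP.toℕ-injective idx
      ...   | refl = trans (B'≡B∘τ β z) (trans (cong (at B) (transpose-β β δ)) content)

      pending' : ∀ ε → InZ S ε → ¬ ε ≺ (i , suc (toℕ u)) → at B' ε ≢ hole → at B' ε ≡ A[ ε ]
      pending' ε z ε⊀ nh with ε ≟P δ
      ... | yes ε≡δ = ⊥-elim (nh (trans (B'≡B∘τ ε z)
                        (trans (cong (λ x → at B (transpose β δ x)) ε≡δ)
                               (trans (cong (at B) (transpose-δ β δ δ≢β)) (β-hole δ≢β)))))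
        where δ≢β : δ ≢ β
              δ≢β δ≡β = ε⊀ (subst (_≺ (i , suc (toℕ u))) (sym (trans ε≡δ δ≡β)) (inj₂ (refl , ℕP.≤-refl)))
      ... | no ε≢δ = trans same (pending ε z (ε⊀ ∘ ≺-weaken) (λ h → nh (trans same h)))
        where ε≢β : ε ≢ β
              ε≢β refl = ε⊀ (inj₂ (refl , ℕP.≤-refl))
              same : at B' ε ≡ at B ε
              same = unchanged ε z ε≢β ε≢δ

      holeFree' : ∀ r v → suc K ≤ r → v ∉ S → B' r v ≢ hole
      holeFree' r v K<r v∉S h = holeFree r v (ℕP.≤-trans (ℕP.m≤m⊔n holeFreeFrom i) (ℕP.<⇒≤ K<r)) v∉S
                                  (trans (sym same) h)
        where
          same : B' r v ≡ B r v
          same = unchanged (r , v) v∉S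
                   (λ eq → ℕP.<-irrefl (sym (cong proj₁ eq)) (ℕP.≤-<-trans (ℕP.m≤n⊔m holeFreeFrom i) K<r))
                   (λ eq → ℕP.<-irrefl (sym (cong proj₁ eq)) (ℕP.≤-<-trans row-bound K<r))

  invariant-skip : ∀ i k B → (∀ w → toℕ w ≡ k → w ∈ S) → Invariant i k B → Invariant i (suc k) B
  invariant-skip i k B outside inv = record
    { wellFormed = wellFormed ; settled = settled' ; pending = λ δ z δ⊀ → pending δ z (δ⊀ ∘ ≺-weaken)
    ; holeFreeFrom = holeFreeFrom ; holeFree = holeFree }
    where
      open Invariant inv
      settled' : ∀ δ → InZ S δ → δ ≺ (i , suc k) → at B δ ≡ A'[ δ ]
      settled' δ z lt with ≺-suc lt
      ... | inj₁ lt'       = settled δ z lt'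
      ... | inj₂ (_ , idx) = ⊥-elim (z (outside (proj₂ δ) idx))

  invariant-nextRow : ∀ i B → Invariant i n B → Invariant (suc i) 0 B
  invariant-nextRow i B inv = record
    { wellFormed = wellFormed ; settled = λ δ z lt → settled δ z (≺-nextRow lt)
    ; pending = λ δ z δ⊀ → pending δ z (δ⊀ ∘ ≺-prevRow) ; holeFreeFrom = holeFreeFrom ; holeFree = holeFree }
    where open Invariant inv

  invariant-step : ∀ i k B → Invariant i k B → Invariant i (suc k) (step B i k)
  invariant-step i k B inv with k ℕ.<? n
  ... | no k≮n = invariant-skip i k B (λ w idx → ⊥-elim (k≮n (subst (_< n) idx (FinP.toℕ<n w)))) inv
  ... | yes k<n with Fin.fromℕ< k<n ∈? S
  ...   | yes w∈S = invariant-skip i k B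
                      (λ w idx → subst (_∈ S) (FinP.toℕ-injective (trans (FinP.toℕ-fromℕ< k<n) (sym idx))) w∈S) inv
  ...   | no w∉S  = subst (λ x → Invariant i (suc x) (move B i w (heightTable-S G S i w))) (FinP.toℕ-fromℕ< k<n)
                      (invariant-move i (Fin.fromℕ< k<n) w∉S B
                        (subst (λ x → Invariant i x B) (sym (FinP.toℕ-fromℕ< k<n)) inv))
    where
      w : Fin n
      w = Fin.fromℕ< k<n

  initCell-edge : ∀ x e → initCell x ≡ edge e → x ≡ just e × edgeOf-S G S e ≡ true
  initCell-edge (just f) e h with edgeOf-S G S f in ok
  initCell-edge (just f) .f refl | true = refl , ok

  initCell-not-hole : ∀ x → initCell x ≢ hole → initCell x ≡ toCell x
  initCell-not-hole nothing  _ = refl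
  initCell-not-hole (just f) nh with edgeOf-S G S f
  ... | true  = refl
  ... | false = ⊥-elim (nh refl)

  initCell-hole : ∀ x → initCell x ≡ hole → Σ (Fin m) (λ e → x ≡ just e × edgeOf-S G S e ≡ false)
  initCell-hole (just f) h with edgeOf-S G S f in meets
  ... | false = f , refl , meets

  -- the initial array: every edge of G - S sits in its cell of A, which lies in Z
  -- because both endpoints avoid S; rows from m on are empty
  invariant-initial : Invariant 0 0 initial
  invariant-initial = record
    { wellFormed = (λ ε _ e h → proj₂ (initCell-edge (heightTable G (proj₁ ε) (proj₂ ε)) e h)) , located
    ; settled = λ { δ z (inj₁ ()) ; δ z (inj₂ (_ , ())) }
    ; pending = λ δ _ _ nh → initCell-not-hole (heightTable G (proj₁ δ) (proj₂ δ)) nh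
    ; holeFreeFrom = m ; holeFree = holeFree }
    where
      located : ∀ e → edgeOf-S G S e ≡ true →
        Σ (Pos n) (λ ε → InZ S ε × at initial ε ≡ edge e) ×
        (∀ ε ε' → InZ S ε → InZ S ε' → at initial ε ≡ edge e → at initial ε' ≡ edge e → ε ≡ ε')
      located e e-ok = (c , c∈Z , initial-c) , unique
        where
          cell : A.EarlierCell (suc m) 0 e
          cell = A.table-complete e (proj₁ (ends G e)) refl (endpoint⇒incident G e _ (inj₁ refl)) refl
          c : Pos n
          c = proj₁ cell
          Ac : heightTable G (proj₁ c) (proj₂ c) ≡ just e
          Ac = proj₂ (proj₂ (proj₂ cell))
          ends∉S : notInS S (proj₁ (ends G e)) ≡ true × notInS S (proj₂ (ends G e)) ≡ true
          ends∉S = ∧-true e-ok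
          c∈Z : InZ S c
          c∈Z with incident⇒endpoint G e (proj₂ c) (A.table-incident (proj₁ c) (proj₂ c) e Ac)
          ... | inj₁ p = subst (_∉ S) p (notInS⇒∉ S _ (proj₁ ends∉S))
          ... | inj₂ p = subst (_∉ S) p (notInS⇒∉ S _ (proj₂ ends∉S))
          initial-c : at initial c ≡ edge e
          initial-c rewrite Ac | e-ok = refl
          unique : ∀ ε ε' → InZ S ε → InZ S ε' → at initial ε ≡ edge e → at initial ε' ≡ edge e → ε ≡ ε'
          unique ε ε' _ _ h h' = A.table-injective ε ε' e refl refl
            (proj₁ (initCell-edge (heightTable G (proj₁ ε) (proj₂ ε)) e h))
            (proj₁ (initCell-edge (heightTable G (proj₁ ε') (proj₂ ε')) e h'))
      holeFree : ∀ r v → m ≤ r → v ∉ S → initial r v ≢ hole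
      holeFree r v m≤r _ with heightTable G r v in Arv
      ... | nothing = λ ()
      ... | just f  = ⊥-elim (ℕP.<-irrefl refl (ℕP.<-≤-trans (A.table-row<m r v f refl Arv) m≤r))

  invariant : ∀ i k → Invariant i k (state i k)
  invariant i       (suc k) = invariant-step i k (state i k) (invariant i k)
  invariant zero    zero    = invariant-initial
  invariant (suc i) zero    = invariant-nextRow i (state i n) (invariant i n)

  S-endpoint : Fin m → Fin n
  S-endpoint e = if ⌊ proj₁ (ends G e) ∈? S ⌋ then proj₁ (ends G e) else proj₂ (ends G e)

  S-endpoint-∈ : ∀ e → edgeOf-S G S e ≡ false → S-endpoint e ∈ S
  S-endpoint-∈ e meets with proj₁ (ends G e) ∈? S
  ... | yes p = p
  ... | no _  = notInS-false S _ meets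

  S-endpoint-incident : ∀ e → incident? G e (S-endpoint e) ≡ true
  S-endpoint-incident e with ⌊ proj₁ (ends G e) ∈? S ⌋
  ... | true  = endpoint⇒incident G e _ (inj₁ refl)
  ... | false = endpoint⇒incident G e _ (inj₂ refl)

  -- a hole at (r , u) of the initial array comes from the edge of A joining u to
  -- a vertex of S; distinct rows give distinct such vertices, as G has no
  -- parallel edges and an edge occupies one cell of A
  initial-holes : ∀ u → u ∉ S → ∀ N → holesBelow initial u N ≤ ∣ S ∣
  initial-holes u u∉S N = holes-injection initial u g g-injective N S (λ r _ h → g∈S r h)
    where
      g : ℕ → Fin n
      g r with heightTable G r u
      ... | just e  = S-endpoint e
      ... | nothing = u

      g∈S : ∀ r → initial r u ≡ hole → g r ∈ S
      g∈S r h with initCell-hole (heightTable G r u) h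
      ... | e , Ar , meets rewrite Ar = S-endpoint-∈ e meets

      joins : ∀ r → initial r u ≡ hole → Σ (Fin m) (λ e → heightTable G r u ≡ just e × IsEdge G e u (g r))
      joins r h with initCell-hole (heightTable G r u) h
      ... | e , Ar , meets rewrite Ar =
        e , refl , incident⇒IsEdge G e u (S-endpoint e) (A.table-incident r u e Ar) (S-endpoint-incident e)
                     (λ u≡w → u∉S (subst (_∈ S) (sym u≡w) (S-endpoint-∈ e meets)))

      g-injective : ∀ r r' → initial r u ≡ hole → initial r' u ≡ hole → g r ≡ g r' → r ≡ r'
      g-injective r r' h h' same with joins r h | joins r' h'
      ... | e , Ar , e-uw | e' , Ar' , e'-uw' =
        cong proj₁ (A.table-injective (r , u) (r' , u) e refl refl Ar
                      (subst (λ x → heightTable G r' u ≡ just x) (sym e≡e') Ar'))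
        where
          e≡e' : e ≡ e'
          e≡e' = IsEdge-unique G e e' u (g r) e-uw (subst (IsEdge G e' u) (sym same) e'-uw')

  step-skip : ∀ B i k → (∀ w → toℕ w ≡ k → w ∈ S) → step B i k ≡ B
  step-skip B i k outside with k ℕ.<? n
  ... | no _ = refl
  ... | yes k<n with Fin.fromℕ< k<n ∈? S
  ...   | yes _   = refl
  ...   | no w∉S  = ⊥-elim (w∉S (outside _ (FinP.toℕ-fromℕ< k<n)))

  step-visit : ∀ B i u → u ∉ S → step B i (toℕ u) ≡ move B i u (heightTable-S G S i u)
  step-visit B i u u∉S with toℕ u ℕ.<? n
  ... | no u≮n = ⊥-elim (u≮n (FinP.toℕ<n u))
  ... | yes u<n rewrite FinP.fromℕ<-toℕ u u<n with u ∈? S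
  ...   | yes u∈S = ⊥-elim (u∉S u∈S)
  ...   | no _    = refl

  state-skip : ∀ i k d → (∀ w → k ≤ toℕ w → toℕ w < k + d → w ∈ S) → state i (k + d) ≡ state i k
  state-skip i k zero    outside = cong (state i) (ℕP.+-identityʳ k)
  state-skip i k (suc d) outside = begin
      state i (k + suc d)
    ≡⟨ cong (state i) (ℕP.+-suc k d) ⟩
      step (state i (k + d)) i (k + d)
    ≡⟨ step-skip (state i (k + d)) i (k + d)
         (λ w idx → outside w (subst (k ≤_) (sym idx) (ℕP.m≤m+n k d))
                              (subst (_< k + suc d) (sym idx) (ℕP.+-monoʳ-< k ℕP.≤-refl))) ⟩
      state i (k + d)
    ≡⟨ state-skip i k d (λ w lo hi → outside w lo (ℕP.<-≤-trans hi (ℕP.+-monoʳ-≤ k (ℕP.n≤1+n d)))) ⟩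
      state i k ∎
    where open ≡-Reasoning

  state-rows-skip : ∀ a d → (∀ r → a ≤ r → r < a + d → ∀ w → w ∈ S) → state (a + d) 0 ≡ state a 0
  state-rows-skip a zero    outside = cong (λ x → state x 0) (ℕP.+-identityʳ a)
  state-rows-skip a (suc d) outside = begin
      state (a + suc d) 0
    ≡⟨ cong (λ x → state x 0) (ℕP.+-suc a d) ⟩
      state (a + d) (0 + n)
    ≡⟨ state-skip (a + d) 0 n (λ w _ _ → outside (a + d) (ℕP.m≤m+n a d) (ℕP.+-monoʳ-< a ℕP.≤-refl) w) ⟩
      state (a + d) 0
    ≡⟨ state-rows-skip a d (λ r lo hi → outside r lo (ℕP.<-≤-trans hi (ℕP.+-monoʳ-≤ a (ℕP.n≤1+n d)))) ⟩
      state a 0 ∎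
    where open ≡-Reasoning

  between-successor : ∀ β γ → IsSuccZ S β γ → ∀ δ → β <Z δ → δ <Z γ → proj₂ δ ∈ S
  between-successor β γ (_ , _ , least) δ β<δ δ<γ with proj₂ δ ∈? S
  ... | yes δ∉Z = δ∉Z
  ... | no δ∈Z  = ⊥-elim (≤Z⇒⊀ γ δ (least δ δ∈Z β<δ) δ<γ)

  state-successor : ∀ i u γ → IsSuccZ S (i , u) γ → Arr γ ≡ state i (suc (toℕ u))
  state-successor i u (j , v) succ@(_ , inj₂ (refl , u<v) , _) =
    trans (cong (state i) (sym (ℕP.m+[n∸m]≡n u<v)))
          (state-skip i (suc (toℕ u)) (toℕ v ∸ suc (toℕ u))
            (λ w lo hi → between (i , w) (inj₂ (refl , lo))
                                 (inj₂ (refl , subst (toℕ w <_) (ℕP.m+[n∸m]≡n u<v) hi))))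
    where
      between : ∀ δ → (i , u) <Z δ → δ <Z (j , v) → proj₂ δ ∈ S
      between = between-successor (i , u) (j , v) succ
  state-successor i u (j , v) succ@(_ , inj₁ i<j , _) = begin
      state j (0 + toℕ v)
    ≡⟨ state-skip j 0 (toℕ v) (λ w _ w<v → between (j , w) (inj₁ i<j) (inj₂ (refl , w<v))) ⟩
      state j 0
    ≡⟨ cong (λ x → state x 0) (sym (ℕP.m+[n∸m]≡n i<j)) ⟩
      state (suc i + (j ∸ suc i)) 0
    ≡⟨ state-rows-skip (suc i) (j ∸ suc i)
         (λ r i<r r<j w → between (r , w) (inj₁ i<r) (inj₁ (subst (r <_) (ℕP.m+[n∸m]≡n i<j) r<j))) ⟩
      state i n
    ≡⟨ cong (state i) (sym (ℕP.m+[n∸m]≡n (FinP.toℕ<n u))) ⟩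
      state i (suc (toℕ u) + (n ∸ suc (toℕ u)))
    ≡⟨ state-skip i (suc (toℕ u)) (n ∸ suc (toℕ u)) (λ w u<w _ → between (i , w) (inj₂ (refl , u<w)) (inj₁ i<j)) ⟩
      state i (suc (toℕ u)) ∎
    where
      open ≡-Reasoning
      between : ∀ δ → (i , u) <Z δ → δ <Z (j , v) → proj₂ δ ∈ S
      between = between-successor (i , u) (j , v) succ

  minimum-row : ∀ α → IsMinZ S α → proj₁ α ≡ 0
  minimum-row (i₀ , u₀) (z , least) with least (0 , u₀) z
  ... | inj₁ (inj₁ ())
  ... | inj₁ (inj₂ (i₀≡0 , _)) = i₀≡0
  ... | inj₂ α≡ = cong proj₁ α≡

  state-minimum : ∀ α → IsMinZ S α → Arr α ≡ initial
  state-minimum (i₀ , u₀) min@(_ , least) with minimum-row (i₀ , u₀) min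
  ... | refl = state-skip 0 0 (toℕ u₀) (λ w _ w<u₀ → outside w w<u₀)
    where
      outside : ∀ w → toℕ w < toℕ u₀ → w ∈ S
      outside w w<u₀ with w ∈? S
      ... | yes w∉Z = w∉Z
      ... | no w∈Z  = ⊥-elim (≤Z⇒⊀ (0 , u₀) (0 , w) (least (0 , w) w∈Z) (inj₂ (refl , w<u₀)))

  well-formed : ∀ β → WellFormed G S (Arr β)
  well-formed (i , u) = Invariant.wellFormed (invariant i (toℕ u))

  initial-hole-bound : ∀ α → IsMinZ S α → ∀ u → InZ S (0 , u) → ∀ N → holesBelow (Arr α) u N ≤ ∣ S ∣
  initial-hole-bound α min u u∉S N =
    subst (λ B → holesBelow B u N ≤ ∣ S ∣) (sym (state-minimum α min)) (initial-holes u u∉S N)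

  agrees-with-A' : ∀ β → ∀ δ → InZ S δ → δ <Z β → at (Arr β) δ ≡ A'[ δ ]
  agrees-with-A' (i , u) = Invariant.settled (invariant i (toℕ u))

  agrees-with-A : ∀ β → ∀ δ → InZ S δ → β ≤Z δ → at (Arr β) δ ≢ hole → at (Arr β) δ ≡ A[ δ ]
  agrees-with-A (i , u) δ z β≤δ = Invariant.pending (invariant i (toℕ u)) δ z (≤Z⇒⊀ (i , u) δ β≤δ)

  successor-swap : ∀ β → InZ S β → ∀ γ → IsSuccZ S β γ →
    Σ (Pos n) (λ δ → InCritical S (Arr β) β δ ×
      (∀ ε → InZ S ε → at (Arr γ) ε ≡ at (swap (Arr β) β δ) ε) ×
      (proj₂ β ≢ proj₂ δ → Σ (Fin m) (λ e → at (Arr β) δ ≡ edge e × IsEdge G e (proj₂ β) (proj₂ δ))))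
  successor-swap (i , u) u∉S γ succ = δ , critical , is-swap' , cross-edge
    where
      open SwapTarget (swap-target i u u∉S (Arr (i , u)) (invariant i (toℕ u)))
      Arrγ : Arr γ ≡ move (Arr (i , u)) i u (heightTable-S G S i u)
      Arrγ = trans (state-successor i u γ succ) (step-visit (Arr (i , u)) i u u∉S)
      is-swap' : ∀ ε → InZ S ε → at (Arr γ) ε ≡ at (swap (Arr (i , u)) (i , u) δ) ε
      is-swap' ε z = trans (cong (λ B → at B ε) Arrγ) (is-swap ε z)

lemma3p1 : ∀ {n m : ℕ} (G : TOGraph n m) (S : Subset n) →
    Σ (Pos n → Array n m) (λ Arr →
      (∀ β → InZ S β → WellFormed G S (Arr β)) ×
      (∀ α → IsMinZ S α → ∀ u → InZ S (0 , u) → ∀ N → holesBelow (Arr α) u N ≤ ∣ S ∣) ×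
      (∀ β → InZ S β →
        (∀ δ → InZ S δ → δ <Z β → at (Arr β) δ ≡ toCell (heightTable-S G S (proj₁ δ) (proj₂ δ))) ×
        (∀ δ → InZ S δ → β ≤Z δ → at (Arr β) δ ≢ hole →
           at (Arr β) δ ≡ toCell (heightTable G (proj₁ δ) (proj₂ δ))) ×
        (∀ γ → IsSuccZ S β γ →
           Σ (Pos n) (λ δ → InCritical S (Arr β) β δ ×
             (∀ ε → InZ S ε → at (Arr γ) ε ≡ at (swap (Arr β) β δ) ε) ×
             (proj₂ β ≢ proj₂ δ →
               Σ (Fin m) (λ e → at (Arr β) δ ≡ edge e × IsEdge G e (proj₂ β) (proj₂ δ)))))))
lemma3p1 G S =
  Arr , (λ β _ → well-formed β) , initial-hole-bound ,
  λ β β∈Z → agrees-with-A' β , agrees-with-A β , successor-swap β β∈Z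
  where open Sweep G S
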